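{- Assume $n$ is even and let $\lambda=(\lambda_1\ge\dots\ge\lambda_n\ge0)$ be a partition. Then $$P_{\rho_{n-1}+\lambda}(x_1,\dots,x_n|t)=\prod_{1\le i<j\le n}(x_i+x_j)\cdot s_\lambda(x_1,\dots,x_n|t),$$ where $\rho_{n-1}=(n-1,n-2,\dots,1,0)$ is regarded as having $n$ parts.
   Context: $t=(t_1,t_2,\dots)$ and $x_1,\dots,x_n$ are indeterminates. For a sequence $a$ put $(y|a)^k=\prod_{i=1}^k(y-a_i)$. For a strict partition $\mu$ with $r\le n$ nonzero parts $\mu_1>\dots>\mu_r>0$ (zero parts ignored), $P_\mu(x_1,\dots,x_n|a)=\frac1{(n-r)!}\sum_{w\in S_n}w\big(\prod_{i=1}^r(x_i|a)^{\mu_i}\prod_{i\le r,\,i<j\le n}\frac{x_i+x_j}{x_i-x_j}\big)$, where $S_n$ permutes the $x_i$. The factorial Schur polynomial is $s_\lambda(x_1,\dots,x_n|t)=\det\big((x_j|t)^{\lambda_i+n-i}\big)_{1\le i,j\le n}/\prod_{1\le i<j\le n}(x_i-x_j)$. -}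

module Defs where

open import Data.Bool using (Bool; true; false; _∧_; _∨_; not; if_then_else_)
open import Data.Nat as ℕ using (ℕ; zero; suc; _∸_; _<ᵇ_)
open import Data.Nat.Base using (_!)
open import Data.Integer using (+_)
open import Data.Fin using (Fin; toℕ)
open import Data.Fin.Properties using () renaming (_≟_ to _≟ᶠ_)
open import Data.List using (List; []; _∷_; [_]; map; foldr; concatMap; filterᵇ; allFin; upTo; length; cartesianProduct)
open import Data.Bool.ListAction using (and)
open import Data.Vec.Functional using () renaming (_∷_ to _∷ᶠ_)
open import Data.Product using (_×_; _,_; proj₁; proj₂)
open import Data.Rational using (ℚ; 0ℚ; 1ℚ; _+_; _*_; _-_; -_; _÷_; _/_; ≢-nonZero)
open import Data.Rational.Properties using (_≟_)
open import Relation.Nullary using (yes; no; does)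

ΣL : List ℚ → ℚ
ΣL = foldr _+_ 0ℚ

ΠL : List ℚ → ℚ
ΠL = foldr _*_ 1ℚ

-- Total division on ℚ (p ÷' 0 = 0); only used with nonzero divisors below.
_÷'_ : ℚ → ℚ → ℚ
p ÷' q with q ≟ 0ℚ
... | yes _ = 0ℚ
... | no q≢0 = _÷_ p q {{≢-nonZero q≢0}}

ℕtoℚ : ℕ → ℚ
ℕtoℚ m = (+ m) / 1

allFuns : (n m : ℕ) → List (Fin n → Fin m)
allFuns zero    m = [ (λ ()) ]
allFuns (suc n) m = concatMap (λ f → map (λ k → k ∷ᶠ f) (allFin m)) (allFuns n m)

isInjᵇ : {n : ℕ} → (Fin n → Fin n) → Bool
isInjᵇ {n} f = and (map (λ p → does (proj₁ p ≟ᶠ proj₂ p) ∨ not (does (f (proj₁ p) ≟ᶠ f (proj₂ p))))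
                        (cartesianProduct (allFin n) (allFin n)))

Perms : (n : ℕ) → List (Fin n → Fin n)
Perms n = filterᵇ isInjᵇ (allFuns n n)

pairs< : (n : ℕ) → List (Fin n × Fin n)
pairs< n = filterᵇ (λ p → toℕ (proj₁ p) <ᵇ toℕ (proj₂ p)) (cartesianProduct (allFin n) (allFin n))

sgn : {n : ℕ} → (Fin n → Fin n) → ℚ
sgn {n} w = ΠL (map (λ p → if toℕ (w (proj₂ p)) <ᵇ toℕ (w (proj₁ p)) then - 1ℚ else 1ℚ) (pairs< n))

-- Factorial power (y|a)^k = ∏_{i=1}^k (y - a_i); the sequence a = (a_1,a_2,…)
-- is encoded as a : ℕ → ℚ with a 0 = a_1, a 1 = a_2, …
fpow : (a : ℕ → ℚ) → ℚ → ℕ → ℚ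
fpow a y k = ΠL (map (λ m → y - a m) (upTo k))

nth : List ℕ → ℕ → ℕ
nth []       _       = 0
nth (m ∷ _)  zero    = m
nth (_ ∷ μ)  (suc i) = nth μ i

-- Factorial Q-function P_μ(x_1,…,x_n | a) for a strict partition μ given
-- as the list of its nonzero parts μ_1 > … > μ_r > 0 (r = length μ ≤ n).
-- A permutation w acts by x_i ↦ x_{w(i)}.
Pfun : (n : ℕ) → (μ : List ℕ) → (a : ℕ → ℚ) → (x : Fin n → ℚ) → ℚ
Pfun n μ a x =
  ΣL (map (λ w → term (λ i → x (w i))) (Perms n)) ÷' ℕtoℚ ((n ∸ r) !)
  where
  r = length μ
  term : (Fin n → ℚ) → ℚ
  term y =
    ΠL (map (λ i → if toℕ i <ᵇ r then fpow a (y i) (nth μ (toℕ i)) else 1ℚ) (allFin n))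
    * ΠL (map (λ p → if toℕ (proj₁ p) <ᵇ r
                       then (y (proj₁ p) + y (proj₂ p)) ÷' (y (proj₁ p) - y (proj₂ p))
                       else 1ℚ) (pairs< n))

det : (n : ℕ) → (Fin n → Fin n → ℚ) → ℚ
det n M = ΣL (map (λ w → sgn w * ΠL (map (λ i → M i (w i)) (allFin n))) (Perms n))

vandermonde : (n : ℕ) → (Fin n → ℚ) → ℚ
vandermonde n x = ΠL (map (λ p → x (proj₁ p) - x (proj₂ p)) (pairs< n))

plusProd : (n : ℕ) → (Fin n → ℚ) → ℚ
plusProd n x = ΠL (map (λ p → x (proj₁ p) + x (proj₂ p)) (pairs< n))

-- Factorial Schur polynomial s_λ(x_1,…,x_n | t), λ given as λ : Fin n → ℕ
-- (λ (i-1) = λ_i); exponent λ_i + n - i (1-based i) = λ i + (n - 1 - i) (0-based).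
schur : (n : ℕ) → (λ' : Fin n → ℕ) → (t : ℕ → ℚ) → (x : Fin n → ℚ) → ℚ
schur n λ' t x =
  det n (λ i j → fpow t (x j) (λ' i ℕ.+ (n ∸ 1 ∸ toℕ i))) ÷' vandermonde n x

IsPartition : (n : ℕ) → (Fin n → ℕ) → Set
IsPartition n λ' = ∀ (i j : Fin n) → toℕ i ℕ.≤ toℕ j → λ' j ℕ.≤ λ' i

rhoPlus : (n : ℕ) → (Fin n → ℕ) → List ℕ
rhoPlus n λ' = filterᵇ (λ m → 0 <ᵇ m) (map (λ i → (n ∸ 1 ∸ toℕ i) ℕ.+ λ' i) (allFin n))

-- The parts of ρ_{n-1} + λ are strictly decreasing, so at most one of them is zero: r ≥ n - 1.
-- Hence the normalisation (n - r)! is 1 and the cross factor runs over all pairs i < j. That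
-- factor (x_i + x_j)/(x_i - x_j) is antisymmetric, so relabelling the variables by w multiplies
-- the product over pairs by sgn w, while the factorial powers (x_{w i} | t)^{λ_i + n - i} are the
-- entries of the Schur determinant. Summing over S_n therefore gives
-- ∏ (x_i + x_j) / ∏ (x_i - x_j) times the Leibniz expansion of that determinant.

module Submission where

open import Defs
open import Data.Nat using (ℕ)
open import Data.Nat.Divisibility using (_∣_)
open import Data.Fin using (Fin)
open import Data.Rational using (ℚ; _*_)
open import Relation.Binary.PropositionalEquality using (_≡_)

open import Data.Bool using (Bool; true; false; T; _∨_; not; if_then_else_)
open import Data.Empty using (⊥-elim)
open import Data.Fin using (toℕ; zero; suc)
open import Data.Fin.Properties using (toℕ<n; toℕ-injective) renaming (_≟_ to _≟ᶠ_)
open import Data.List using (List; []; _∷_; _++_; map; length; filterᵇ; allFin; tabulate; cartesianProduct)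
open import Data.List.Membership.Propositional using (_∈_)
open import Data.List.Membership.Propositional.Properties
  using (∈-∃++; ∈-map⁻; ∈-filter⁺; ∈-filter⁻; ∈-cartesianProduct⁺; ∈-allFin)
open import Data.List.Properties using (map-cong-local; map-∘; length-map; map-tabulate; length-tabulate)
open import Data.List.Relation.Binary.Permutation.Propositional using (_↭_; ↭-sym; ↭-trans; ↭-prep; ↭⇒↭ₛ)
open import Data.List.Relation.Binary.Permutation.Propositional.Properties as PermProps using (shift; ∈-resp-↭; ↭-length)
import Data.List.Relation.Binary.Permutation.Setoid.Properties as PermutationSetoid
open import Data.List.Relation.Binary.Subset.Propositional using (_⊆_)
open import Data.List.Relation.Unary.All as All using (All)
import Data.List.Relation.Unary.All.Properties as All
open import Data.List.Relation.Unary.AllPairs using (AllPairs; []; _∷_)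
open import Data.List.Relation.Unary.AllPairs.Properties using (tabulate⁺-<)
open import Data.List.Relation.Unary.Any using (here; there)
open import Data.List.Relation.Unary.Unique.Propositional using (Unique)
open import Data.List.Relation.Unary.Unique.Propositional.Properties using (filter⁺; cartesianProduct⁺; allFin⁺)
open import Data.Nat as ℕ using (zero; suc; _<ᵇ_; _<_; _≤_; _>_; _∸_; _!; z≤n; s≤s)
open import Data.Nat.Properties as ℕ
  using (<ᵇ⇒<; <⇒<ᵇ; ≮⇒≥; <-irrefl; <-asym; ≤∧≢⇒<; <⇒≤; ≤-pred; ≤-trans; <-≤-trans; ∸-monoʳ-<; ∸-monoˡ-≤; +-mono-<-≤; m+n∸n≡m)
open import Data.Product using (_×_; _,_; proj₁; proj₂; uncurry′)
open import Data.Rational using (0ℚ; 1ℚ; _+_; _-_; -_; 1/_; ≢-nonZero)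
open import Data.Rational.Properties
  using (_≟_; 1≢0; *-inverseˡ; *-identityˡ; *-identityʳ; *-zeroˡ; *-zeroʳ; *-1-isCommutativeMonoid)
open import Data.Rational.Solver using (module +-*-Solver)
open import Function using (_∘_)
open import Relation.Binary.Core using (_Preserves_⟶_)
open import Function.Definitions using (Injective)
open import Relation.Binary.PropositionalEquality
  using (_≢_; refl; sym; trans; cong; cong₂; subst; setoid; module ≡-Reasoning)
open import Relation.Nullary using (yes; no; does; Dec; T?)

open +-*-Solver

recip : ℚ → ℚ
recip q = 1ℚ ÷' q

÷'≡*recip : ∀ p q → p ÷' q ≡ p * recip q
÷'≡*recip p q with q ≟ 0ℚ
... | yes _ = sym (*-zeroʳ p)
... | no _  = cong (p *_) (sym (*-identityˡ _))

recip-inverseˡ : ∀ q → q ≢ 0ℚ → recip q * q ≡ 1ℚ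
recip-inverseˡ q q≢0 with q ≟ 0ℚ
... | yes q≡0 = ⊥-elim (q≢0 q≡0)
... | no q≢0′ = trans (cong (_* q) (*-identityˡ ((1/ q) {{≢-nonZero q≢0′}})))
                      (*-inverseˡ q {{≢-nonZero q≢0′}})

recip-unique : ∀ q r → q ≢ 0ℚ → r * q ≡ 1ℚ → recip q ≡ r
recip-unique q r q≢0 rq≡1 = begin
  recip q                 ≡⟨ sym (*-identityˡ _) ⟩
  1ℚ * recip q            ≡⟨ cong (_* recip q) (sym rq≡1) ⟩
  (r * q) * recip q       ≡⟨ solve 3 (λ r q i → (r :* q) :* i := r :* (i :* q)) refl r q (recip q) ⟩
  r * (recip q * q)       ≡⟨ cong (r *_) (recip-inverseˡ q q≢0) ⟩
  r * 1ℚ                  ≡⟨ *-identityʳ r ⟩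
  r                       ∎
  where open ≡-Reasoning

recip-* : ∀ p q → recip (p * q) ≡ recip p * recip q
recip-* p q = cases (p ≟ 0ℚ) (q ≟ 0ℚ)
  where
  cases : Dec (p ≡ 0ℚ) → Dec (q ≡ 0ℚ) → recip (p * q) ≡ recip p * recip q
  cases (yes refl) _        = trans (cong recip (*-zeroˡ q)) (sym (*-zeroˡ (recip q)))
  cases (no _)     (yes refl) = trans (cong recip (*-zeroʳ p)) (sym (*-zeroʳ (recip p)))
  cases (no p≢0)   (no q≢0)   = recip-unique (p * q) (recip p * recip q) pq≢0 inverse
    where
    inverse : (recip p * recip q) * (p * q) ≡ 1ℚ
    inverse = trans (solve 4 (λ a b c d → (a :* b) :* (c :* d) := (a :* c) :* (b :* d)) refl
                             (recip p) (recip q) p q)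
                    (cong₂ _*_ (recip-inverseˡ p p≢0) (recip-inverseˡ q q≢0))
    pq≢0 : p * q ≢ 0ℚ
    pq≢0 pq≡0 = 1≢0 (trans (sym inverse) (trans (cong (recip p * recip q *_) pq≡0) (*-zeroʳ (recip p * recip q))))

÷'-*-÷' : ∀ a b c d → (a ÷' b) * (c ÷' d) ≡ (a * c) ÷' (b * d)
÷'-*-÷' a b c d rewrite ÷'≡*recip a b | ÷'≡*recip c d | ÷'≡*recip (a * c) (b * d) | recip-* b d =
  solve 4 (λ a c x y → (a :* x) :* (c :* y) := (a :* c) :* (x :* y)) refl a c (recip b) (recip d)

÷'-1 : ∀ a → a ÷' 1ℚ ≡ a
÷'-1 a = trans (÷'≡*recip a 1ℚ) (*-identityʳ a)

÷'-neg : ∀ a b → a ÷' (- b) ≡ - (a ÷' b)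
÷'-neg a b = begin
  a ÷' (- b)                    ≡⟨ cong₂ _÷'_ (sym (*-identityʳ a)) (solve 1 (λ b → :- b := b :* (:- con 1ℚ)) refl b) ⟩
  (a * 1ℚ) ÷' (b * - 1ℚ)        ≡⟨ sym (÷'-*-÷' a b 1ℚ (- 1ℚ)) ⟩
  (a ÷' b) * (1ℚ ÷' (- 1ℚ))      ≡⟨ solve 1 (λ q → q :* (:- con 1ℚ) := :- q) refl (a ÷' b) ⟩
  - (a ÷' b)                    ∎
  where open ≡-Reasoning

÷'-*-comm : ∀ a b c → (a ÷' b) * c ≡ a * (c ÷' b)
÷'-*-comm a b c rewrite ÷'≡*recip c b | ÷'≡*recip a b =
  solve 3 (λ a c x → (a :* x) :* c := a :* (c :* x)) refl a c (recip b)

ΠL-↭ : ΠL Preserves _↭_ ⟶ _≡_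
ΠL-↭ xs↭ys = PermutationSetoid.foldr-commMonoid (setoid ℚ) *-1-isCommutativeMonoid (↭⇒↭ₛ xs↭ys)

module _ {A : Set} where

  ΠL-map-cong : ∀ {f g : A → ℚ} (xs : List A) → (∀ {z} → z ∈ xs → f z ≡ g z) →
                ΠL (map f xs) ≡ ΠL (map g xs)
  ΠL-map-cong xs f≗g = cong ΠL (map-cong-local (All.tabulate f≗g))

  ΣL-map-cong : ∀ {f g : A → ℚ} (xs : List A) → (∀ {z} → z ∈ xs → f z ≡ g z) →
                ΣL (map f xs) ≡ ΣL (map g xs)
  ΣL-map-cong xs f≗g = cong ΣL (map-cong-local (All.tabulate f≗g))

  ΠL-map-* : ∀ (f g : A → ℚ) xs → ΠL (map (λ z → f z * g z) xs) ≡ ΠL (map f xs) * ΠL (map g xs)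
  ΠL-map-* f g []       = refl
  ΠL-map-* f g (x ∷ xs) rewrite ΠL-map-* f g xs =
    solve 4 (λ a b c d → (a :* b) :* (c :* d) := (a :* c) :* (b :* d)) refl
            (f x) (g x) (ΠL (map f xs)) (ΠL (map g xs))

  ΠL-map-÷' : ∀ (f g : A → ℚ) xs → ΠL (map (λ z → f z ÷' g z) xs) ≡ ΠL (map f xs) ÷' ΠL (map g xs)
  ΠL-map-÷' f g []       = sym (÷'-1 1ℚ)
  ΠL-map-÷' f g (x ∷ xs) rewrite ΠL-map-÷' f g xs = ÷'-*-÷' (f x) (g x) (ΠL (map f xs)) (ΠL (map g xs))

  ΣL-map-*ˡ : ∀ (c : ℚ) (f : A → ℚ) xs → ΣL (map (λ z → c * f z) xs) ≡ c * ΣL (map f xs)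
  ΣL-map-*ˡ c f []       = sym (*-zeroʳ c)
  ΣL-map-*ˡ c f (x ∷ xs) rewrite ΣL-map-*ˡ c f xs =
    solve 3 (λ c a b → c :* a :+ c :* b := c :* (a :+ b)) refl c (f x) (ΣL (map f xs))

  unique-⊆-length⇒↭ : ∀ {xs ys : List A} → Unique xs → Unique ys → xs ⊆ ys →
                      length xs ≡ length ys → xs ↭ ys
  unique-⊆-length⇒↭ {[]}     {[]}    _ _ _ _  = _↭_.refl
  unique-⊆-length⇒↭ {[]}     {_ ∷ _} _ _ _ ()
  unique-⊆-length⇒↭ {x ∷ xs} {ys} (x∉xs ∷ xs!) ys! xs⊆ys |xs|≡|ys|
    with as , bs , refl ← ∈-∃++ (xs⊆ys (here refl)) =
    ↭-trans (↭-prep x (unique-⊆-length⇒↭ xs! rest! xs⊆rest |xs|≡|rest|)) (↭-sym ys↭x∷rest)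
    where
    ys↭x∷rest : as ++ x ∷ bs ↭ x ∷ as ++ bs
    ys↭x∷rest = shift x as bs
    rest! : Unique (as ++ bs)
    rest! with _ ∷ rest! ← PermutationSetoid.Unique-resp-↭ (setoid A) (↭⇒↭ₛ ys↭x∷rest) ys! = rest!
    xs⊆rest : xs ⊆ as ++ bs
    xs⊆rest z∈xs with ∈-resp-↭ ys↭x∷rest (xs⊆ys (there z∈xs))
    ... | here refl   = ⊥-elim (All.lookup x∉xs z∈xs refl)
    ... | there z∈rest = z∈rest
    |xs|≡|rest| : length xs ≡ length (as ++ bs)
    |xs|≡|rest| = ℕ.suc-injective (trans |xs|≡|ys| (↭-length ys↭x∷rest))

  unique-map⁺-on : ∀ {B : Set} (f : A → B) {xs : List A} →
                   (∀ {a b} → a ∈ xs → b ∈ xs → f a ≡ f b → a ≡ b) → Unique xs → Unique (map f xs)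
  unique-map⁺-on f         f-inj []            = []
  unique-map⁺-on f {x ∷ xs} f-inj (x∉xs ∷ xs!) =
    All.map⁺ (All.tabulate λ z∈xs fx≡fz → All.lookup x∉xs z∈xs (f-inj (here refl) (there z∈xs) fx≡fz))
    ∷ unique-map⁺-on f (λ a∈ b∈ → f-inj (there a∈) (there b∈)) xs!

∈-Perms⇒injective : ∀ {n} {w : Fin n → Fin n} → w ∈ Perms n → Injective _≡_ _≡_ w
∈-Perms⇒injective {n} {w} w∈Perms {i} {j} wi≡wj =
  decode (All.lookup (All.all⁺ _ _ (proj₂ (∈-filter⁻ (T? ∘ isInjᵇ) {xs = allFuns n n} w∈Perms)))
                     (∈-cartesianProduct⁺ (∈-allFin i) (∈-allFin j)))
  where
  decode : T (does (i ≟ᶠ j) ∨ not (does (w i ≟ᶠ w j))) → i ≡ j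
  decode t with i ≟ᶠ j | w i ≟ᶠ w j
  ... | yes i≡j | _        = i≡j
  ... | no _    | yes _    = ⊥-elim t
  ... | no _    | no wi≢wj = ⊥-elim (wi≢wj wi≡wj)

pairs<-test : ∀ {n} → Fin n × Fin n → Bool
pairs<-test (i , j) = toℕ i <ᵇ toℕ j

∈-pairs<⁻ : ∀ {n} {i j : Fin n} → (i , j) ∈ pairs< n → toℕ i < toℕ j
∈-pairs<⁻ {n} ij∈ = <ᵇ⇒< _ _ (proj₂ (∈-filter⁻ (T? ∘ pairs<-test) {xs = cartesianProduct (allFin n) (allFin n)} ij∈))

∈-pairs<⁺ : ∀ {n} {i j : Fin n} → toℕ i < toℕ j → (i , j) ∈ pairs< n
∈-pairs<⁺ {i = i} {j} i<j = ∈-filter⁺ (T? ∘ pairs<-test) (∈-cartesianProduct⁺ (∈-allFin i) (∈-allFin j)) (<⇒<ᵇ i<j)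

pairs<-unique : ∀ n → Unique (pairs< n)
pairs<-unique n = filter⁺ (T? ∘ pairs<-test) (cartesianProduct⁺ (allFin⁺ n) (allFin⁺ n))

sortPair : ∀ {n} → Fin n → Fin n → Fin n × Fin n
sortPair i j = if toℕ j <ᵇ toℕ i then (j , i) else (i , j)

module _ {n : ℕ} {w : Fin n → Fin n} (w-inj : Injective _≡_ _≡_ w) where

  sortPair-∘-injectiveOn-pairs< : ∀ {i j k l} → toℕ i < toℕ j → toℕ k < toℕ l →
                                  sortPair (w i) (w j) ≡ sortPair (w k) (w l) → (i , j) ≡ (k , l)
  sortPair-∘-injectiveOn-pairs< {i} {j} {k} {l} i<j k<l eq
    with toℕ (w j) <ᵇ toℕ (w i) | toℕ (w l) <ᵇ toℕ (w k)
  ... | true  | true  = cong₂ _,_ (w-inj (cong proj₂ eq)) (w-inj (cong proj₁ eq))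
  ... | false | false = cong₂ _,_ (w-inj (cong proj₁ eq)) (w-inj (cong proj₂ eq))
  ... | true  | false with refl ← w-inj (cong proj₁ eq) | refl ← w-inj (cong proj₂ eq) = ⊥-elim (<-asym i<j k<l)
  ... | false | true  with refl ← w-inj (cong proj₁ eq) | refl ← w-inj (cong proj₂ eq) = ⊥-elim (<-asym i<j k<l)

  sortPair-∘-∈-pairs< : ∀ {i j} → toℕ i < toℕ j → sortPair (w i) (w j) ∈ pairs< n
  sortPair-∘-∈-pairs< {i} {j} i<j with toℕ (w j) <ᵇ toℕ (w i) in eq
  ... | true  = ∈-pairs<⁺ (<ᵇ⇒< _ _ (subst T (sym eq) _))
  ... | false = ∈-pairs<⁺ (≤∧≢⇒< (≮⇒≥ λ wj<wi → subst T eq (<⇒<ᵇ wj<wi))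
                                 λ wi≡wj → <-irrefl (cong toℕ (w-inj (toℕ-injective wi≡wj))) i<j)

  reindex : Fin n × Fin n → Fin n × Fin n
  reindex (i , j) = sortPair (w i) (w j)

  reindex-pairs<-↭ : map reindex (pairs< n) ↭ pairs< n
  reindex-pairs<-↭ = unique-⊆-length⇒↭
    (unique-map⁺-on reindex (λ ij∈ kl∈ → sortPair-∘-injectiveOn-pairs< (∈-pairs<⁻ ij∈) (∈-pairs<⁻ kl∈))
                    (pairs<-unique n))
    (pairs<-unique n)
    reindex-⊆
    (length-map reindex (pairs< n))
    where
    reindex-⊆ : map reindex (pairs< n) ⊆ pairs< n
    reindex-⊆ z∈ with _ , ij∈ , refl ← ∈-map⁻ reindex z∈ = sortPair-∘-∈-pairs< (∈-pairs<⁻ ij∈)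

  inversionSign : Fin n × Fin n → ℚ
  inversionSign (i , j) = if toℕ (w j) <ᵇ toℕ (w i) then - 1ℚ else 1ℚ

  module _ (f : Fin n → Fin n → ℚ) (f-antisym : ∀ i j → f j i ≡ - f i j) where

    f∘w≡sign*f∘reindex : ∀ ij → f (w (proj₁ ij)) (w (proj₂ ij)) ≡ inversionSign ij * uncurry′ f (reindex ij)
    f∘w≡sign*f∘reindex (i , j) with toℕ (w j) <ᵇ toℕ (w i)
    ... | true rewrite f-antisym (w i) (w j) = solve 1 (λ a → a := (:- con 1ℚ) :* (:- a)) refl (f (w i) (w j))
    ... | false = sym (*-identityˡ _)

    ΠL-pairs<-antisym-∘ : ΠL (map (λ ij → f (w (proj₁ ij)) (w (proj₂ ij))) (pairs< n))
                          ≡ sgn w * ΠL (map (uncurry′ f) (pairs< n))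
    ΠL-pairs<-antisym-∘ = begin
      ΠL (map (λ ij → f (w (proj₁ ij)) (w (proj₂ ij))) (pairs< n))
        ≡⟨ ΠL-map-cong (pairs< n) (λ {ij} _ → f∘w≡sign*f∘reindex ij) ⟩
      ΠL (map (λ ij → inversionSign ij * uncurry′ f (reindex ij)) (pairs< n))
        ≡⟨ ΠL-map-* inversionSign (uncurry′ f ∘ reindex) (pairs< n) ⟩
      sgn w * ΠL (map (uncurry′ f ∘ reindex) (pairs< n))
        ≡⟨ cong (λ zs → sgn w * ΠL zs) (map-∘ (pairs< n)) ⟩
      sgn w * ΠL (map (uncurry′ f) (map reindex (pairs< n)))
        ≡⟨ cong (sgn w *_) (ΠL-↭ (PermProps.map⁺ (uncurry′ f) reindex-pairs<-↭)) ⟩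
      sgn w * ΠL (map (uncurry′ f) (pairs< n))
        ∎
      where open ≡-Reasoning

nth-filter-positive : ∀ {ms} → AllPairs _>_ ms → ∀ k → nth (filterᵇ (0 <ᵇ_) ms) k ≡ nth ms k
nth-filter-positive {[]}              []                k       = refl
nth-filter-positive {zero ∷ []}       _                 zero    = refl
nth-filter-positive {zero ∷ []}       _                 (suc k) = refl
nth-filter-positive {zero ∷ _ ∷ _}    ((() All.∷ _) ∷ _) k
nth-filter-positive {suc m ∷ ms}      (_ ∷ ms>)         zero    = refl
nth-filter-positive {suc m ∷ ms}      (_ ∷ ms>)         (suc k) = nth-filter-positive ms> k

length≤suc-length-filter-positive : ∀ {ms} → AllPairs _>_ ms → length ms ≤ suc (length (filterᵇ (0 <ᵇ_) ms))
length≤suc-length-filter-positive {[]}           []                 = z≤n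
length≤suc-length-filter-positive {zero ∷ []}    _                  = s≤s z≤n
length≤suc-length-filter-positive {zero ∷ _ ∷ _} ((() All.∷ _) ∷ _)
length≤suc-length-filter-positive {suc m ∷ ms}   (_ ∷ ms>)          = s≤s (length≤suc-length-filter-positive ms>)

nth-≥-length : ∀ ms k → length ms ≤ k → nth ms k ≡ 0
nth-≥-length []       k       _          = refl
nth-≥-length (m ∷ ms) (suc k) (s≤s |ms|≤k) = nth-≥-length ms k |ms|≤k

nth-tabulate : ∀ {n} (f : Fin n → ℕ) (i : Fin n) → nth (tabulate f) (toℕ i) ≡ f i
nth-tabulate f zero    = refl
nth-tabulate f (suc i) = nth-tabulate (f ∘ suc) i

<⇒≤∸1 : ∀ {m n} → m < n → m ≤ n ∸ 1
<⇒≤∸1 {n = suc n} (s≤s m≤n) = m≤n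

module _ {n : ℕ} {λ' : Fin n → ℕ} (λ-partition : IsPartition n λ') where

  private
    part : Fin n → ℕ
    part i = (n ∸ 1 ∸ toℕ i) ℕ.+ λ' i

    parts≡tabulate : map part (allFin n) ≡ tabulate part
    parts≡tabulate = map-tabulate (λ i → i) part

    parts-descending : AllPairs _>_ (map part (allFin n))
    parts-descending = subst (AllPairs _>_) (sym parts≡tabulate) (tabulate⁺-< λ {i} {j} i<j →
      +-mono-<-≤ (∸-monoʳ-< i<j (<⇒≤∸1 (toℕ<n j))) (λ-partition i j (<⇒≤ i<j)))

  rhoPlus-nth : ∀ i → nth (rhoPlus n λ') (toℕ i) ≡ λ' i ℕ.+ (n ∸ 1 ∸ toℕ i)
  rhoPlus-nth i = begin
    nth (rhoPlus n λ') (toℕ i)          ≡⟨ nth-filter-positive parts-descending (toℕ i) ⟩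
    nth (map part (allFin n)) (toℕ i)   ≡⟨ cong (λ ms → nth ms (toℕ i)) parts≡tabulate ⟩
    nth (tabulate part) (toℕ i)         ≡⟨ nth-tabulate part i ⟩
    part i                              ≡⟨ ℕ.+-comm (n ∸ 1 ∸ toℕ i) (λ' i) ⟩
    λ' i ℕ.+ (n ∸ 1 ∸ toℕ i)            ∎
    where open ≡-Reasoning

  rhoPlus-length : n ≤ suc (length (rhoPlus n λ'))
  rhoPlus-length = subst (_≤ suc (length (rhoPlus n λ')))
    (trans (length-map part (allFin n)) (length-tabulate (λ i → i)))
    (length≤suc-length-filter-positive parts-descending)

module RhoPlusExpansion (n : ℕ) (λ' : Fin n → ℕ) (λ-partition : IsPartition n λ')
                        (t : ℕ → ℚ) (x : Fin n → ℚ) where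

  μ : List ℕ
  μ = rhoPlus n λ'

  r : ℕ
  r = length μ

  schurEntry : Fin n → Fin n → ℚ
  schurEntry i j = fpow t (x j) (λ' i ℕ.+ (n ∸ 1 ∸ toℕ i))

  schurTerm : (Fin n → Fin n) → ℚ
  schurTerm w = sgn w * ΠL (map (λ i → schurEntry i (w i)) (allFin n))

  plusRatio : ℚ
  plusRatio = plusProd n x ÷' vandermonde n x

  factorialPart : (Fin n → ℚ) → ℚ
  factorialPart y = ΠL (map (λ i → if toℕ i <ᵇ r then fpow t (y i) (nth μ (toℕ i)) else 1ℚ) (allFin n))

  crossPart : (Fin n → ℚ) → ℚ
  crossPart y = ΠL (map (λ ij → if toℕ (proj₁ ij) <ᵇ r
                                  then (y (proj₁ ij) + y (proj₂ ij)) ÷' (y (proj₁ ij) - y (proj₂ ij))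
                                  else 1ℚ) (pairs< n))

  Pfun≡ΣL : Pfun n μ t x ≡ ΣL (map (λ w → factorialPart (x ∘ w) * crossPart (x ∘ w)) (Perms n))
  Pfun≡ΣL = trans (cong (sum ÷'_) (factorial≡1 (n ∸ r) n∸r≤1)) (÷'-1 sum)
    where
    sum : ℚ
    sum = ΣL (map (λ w → factorialPart (x ∘ w) * crossPart (x ∘ w)) (Perms n))
    n∸r≤1 : n ∸ r ≤ 1
    n∸r≤1 = ≤-trans (∸-monoˡ-≤ r (rhoPlus-length λ-partition)) (ℕ.≤-reflexive (m+n∸n≡m 1 r))
    factorial≡1 : ∀ k → k ≤ 1 → ℕtoℚ (k !) ≡ 1ℚ
    factorial≡1 zero          _ = refl
    factorial≡1 (suc zero)    _ = refl
    factorial≡1 (suc (suc k)) (s≤s ())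

  factorialPart-∘ : ∀ w → factorialPart (x ∘ w) ≡ ΠL (map (λ i → schurEntry i (w i)) (allFin n))
  factorialPart-∘ w = ΠL-map-cong (allFin n) λ {i} _ → factor≡entry i
    where
    factor≡entry : ∀ i → (if toℕ i <ᵇ r then fpow t (x (w i)) (nth μ (toℕ i)) else 1ℚ) ≡ schurEntry i (w i)
    factor≡entry i with toℕ i <ᵇ r in i<ᵇr
    ... | true  = cong (fpow t (x (w i))) (rhoPlus-nth λ-partition i)
    ... | false = cong (fpow t (x (w i))) (trans (sym (nth-≥-length μ (toℕ i) r≤i)) (rhoPlus-nth λ-partition i))
      where
      r≤i : r ≤ toℕ i
      r≤i = ≮⇒≥ λ i<r → subst T i<ᵇr (<⇒<ᵇ i<r)

  crossPart-∘ : ∀ {w} → Injective _≡_ _≡_ w → crossPart (x ∘ w) ≡ sgn w * plusRatio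
  crossPart-∘ {w} w-inj = begin
    crossPart (x ∘ w)
      ≡⟨ ΠL-map-cong (pairs< n) (λ {ij} ij∈ → guard-holds ij∈) ⟩
    ΠL (map (λ ij → plusRatioFactor (w (proj₁ ij)) (w (proj₂ ij))) (pairs< n))
      ≡⟨ ΠL-pairs<-antisym-∘ w-inj plusRatioFactor plusRatioFactor-antisym ⟩
    sgn w * ΠL (map (uncurry′ plusRatioFactor) (pairs< n))
      ≡⟨ cong (sgn w *_) (ΠL-map-÷' (λ ij → x (proj₁ ij) + x (proj₂ ij)) (λ ij → x (proj₁ ij) - x (proj₂ ij)) (pairs< n)) ⟩
    sgn w * plusRatio
      ∎
    where
    open ≡-Reasoning
    plusRatioFactor : Fin n → Fin n → ℚ
    plusRatioFactor i j = (x i + x j) ÷' (x i - x j)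
    plusRatioFactor-antisym : ∀ i j → plusRatioFactor j i ≡ - plusRatioFactor i j
    plusRatioFactor-antisym i j =
      trans (cong₂ _÷'_ (solve 2 (λ a b → b :+ a := a :+ b) refl (x i) (x j))
                        (solve 2 (λ a b → b :- a := :- (a :- b)) refl (x i) (x j)))
            (÷'-neg (x i + x j) (x i - x j))
    guard-holds : ∀ {ij} → ij ∈ pairs< n →
                  (if toℕ (proj₁ ij) <ᵇ r then plusRatioFactor (w (proj₁ ij)) (w (proj₂ ij)) else 1ℚ)
                  ≡ plusRatioFactor (w (proj₁ ij)) (w (proj₂ ij))
    guard-holds {i , j} ij∈ with toℕ i <ᵇ r in i<ᵇr
    ... | true  = refl
    ... | false = ⊥-elim (subst T i<ᵇr (<⇒<ᵇ i<r))
      where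
      i<r : toℕ i < r
      i<r = <-≤-trans (∈-pairs<⁻ ij∈) (≤-pred (≤-trans (toℕ<n j) (rhoPlus-length λ-partition)))

  summand≡plusRatio*schurTerm : ∀ {w} → w ∈ Perms n → factorialPart (x ∘ w) * crossPart (x ∘ w) ≡ plusRatio * schurTerm w
  summand≡plusRatio*schurTerm {w} w∈Perms =
    trans (cong₂ _*_ (factorialPart-∘ w) (crossPart-∘ (∈-Perms⇒injective w∈Perms)))
          (solve 3 (λ a s q → a :* (s :* q) := q :* (s :* a)) refl
                 (ΠL (map (λ i → schurEntry i (w i)) (allFin n))) (sgn w) plusRatio)

lemma4p11 : (n : ℕ) → 2 ∣ n → (λ' : Fin n → ℕ) → IsPartition n λ'
    → (t : ℕ → ℚ) → (x : Fin n → ℚ) → (∀ i j → x i ≡ x j → i ≡ j)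
    → Pfun n (rhoPlus n λ') t x ≡ plusProd n x * schur n λ' t x
lemma4p11 n _ λ' λ-partition t x _ = begin
  Pfun n (rhoPlus n λ') t x
    ≡⟨ Pfun≡ΣL ⟩
  ΣL (map (λ w → factorialPart (x ∘ w) * crossPart (x ∘ w)) (Perms n))
    ≡⟨ ΣL-map-cong (Perms n) summand≡plusRatio*schurTerm ⟩
  ΣL (map (λ w → plusRatio * schurTerm w) (Perms n))
    ≡⟨ ΣL-map-*ˡ plusRatio schurTerm (Perms n) ⟩
  plusRatio * det n schurEntry
    ≡⟨ ÷'-*-comm (plusProd n x) (vandermonde n x) (det n schurEntry) ⟩
  plusProd n x * schur n λ' t x
    ∎
  where
  open ≡-Reasoning
  open RhoPlusExpansion n λ' λ-partition t x
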